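{- Let $k\geq 1$ and let $\mathfrak{M}_k$ be the model defined below, with worlds $w_0,\ldots,w_N$ and distinguished worlds $r_k = w_0$ and $c^k_1,\ldots,c^k_k$. Let $i \leq k$ and let $x = w_a$ be a world with $a \leq b$, where $c^k_i = w_b$ (i.e., $x$ lies on the chain between $r_k$ and $c^k_i$, inclusive). Then $\mathfrak{M}_k, x \models \varepsilon_i$ if and only if $x = c^k_i$.
   Context: Modal formulas are built from propositional variables, $\bot$, $\rightarrow$, $\Box$, with Kripke semantics as usual; $\Diamond = \neg\Box\neg$. Abbreviations: $\Box^0\psi=\psi$, $\Box^{m+1}\psi=\Box\Box^m\psi$, $\Box^{\leqslant 0}\psi=\psi$, $\Box^{\leqslant m+1}\psi=\Box^{\leqslant m}\psi\wedge\Box^{m+1}\psi$, $\Diamond^m\psi=\neg\Box^m\neg\psi$. Fix a propositional variable $p$ and set $\varepsilon_i = \Box^{\leqslant i}\neg p \wedge \Diamond^{i+1}p$ for $i\in\mathbb{N}$. The model $\mathfrak{M}_k$ is a finite chain $w_0,w_1,\ldots,w_N$ with accessibility relation $w_a R_k w_b$ iff $|a-b|\le 1$ (so reflexive and symmetric). Calling worlds where $p$ is true $p$-worlds and the others $\bar p$-worlds, the chain consists, in order, of: the root $r_k=w_0$ (a $p$-world); then a block of $3$ $\bar p$-worlds; then one $p$-world; then a block of $5$ $\bar p$-worlds; then one $p$-world; $\ldots$; in general for $j=1,\ldots,k$ a block of $2j+1$ $\bar p$-worlds, consecutive blocks separated by a single $p$-world; after the $k$-th block (of $2k+1$ $\bar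 p$-worlds) come three final $p$-worlds. The valuation makes $p$ true exactly at the $p$-worlds. For $j\in\{1,\ldots,k\}$, $c^k_j$ denotes the middle world of the $j$-th block of $2j+1$ $\bar p$-worlds. -}

module Defs where

open import Data.Nat using (ℕ; zero; suc; _+_; _*_; _∸_; _≤_; ∣_-_∣)
open import Data.Bool using (Bool; true; false; T)
open import Data.List using (List; []; _∷_; _++_; replicate; length; lookup)
open import Data.Fin using (Fin; toℕ)
open import Data.Empty using (⊥)

data Fm : Set where
  var  : ℕ → Fm
  ⊥'   : Fm
  _⇒_  : Fm → Fm → Fm
  □_   : Fm → Fm

infixr 5 _⇒_
infix 7 □_

¬'_ : Fm → Fm
¬' φ = φ ⇒ ⊥'

infix 7 ¬'_

_∧'_ : Fm → Fm → Fm
φ ∧' ψ = ¬' (φ ⇒ ¬' ψ)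

◇_ : Fm → Fm
◇ φ = ¬' □ ¬' φ

infix 7 ◇_

□^ : ℕ → Fm → Fm
□^ zero    φ = φ
□^ (suc m) φ = □ (□^ m φ)

□^≤ : ℕ → Fm → Fm
□^≤ zero    φ = φ
□^≤ (suc m) φ = □^≤ m φ ∧' □^ (suc m) φ

◇^ : ℕ → Fm → Fm
◇^ m φ = ¬' □^ m (¬' φ)

p : Fm
p = var 0

ε : ℕ → Fm
ε i = □^≤ i (¬' p) ∧' ◇^ (suc i) p

record Model : Set₁ where
  field
    W : Set
    R : W → W → Set
    V : ℕ → W → Set

open Model public

_,_⊨_ : (M : Model) → W M → Fm → Set
M , w ⊨ var n  = V M n w
M , w ⊨ ⊥'     = ⊥
M , w ⊨ (φ ⇒ ψ) = M , w ⊨ φ → M , w ⊨ ψ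
M , w ⊨ (□ φ)  = ∀ v → R M w v → M , v ⊨ φ

-- The model 𝔐_k
-- 'true' marks a p-world, 'false' a p̄-world.

-- mid j = block 1 (3 p̄-worlds), p-world, block 2 (5 p̄), p-world, …, block j (2j+1 p̄)
mid : ℕ → List Bool
mid zero                = []
mid (suc zero)          = replicate 3 false
mid (suc (suc m))       = mid (suc m) ++ (true ∷ replicate (2 * (suc (suc m)) + 1) false)

-- the whole chain w_0 … w_N: root p-world, the k blocks, three final p-worlds
chain : ℕ → List Bool
chain k = true ∷ (mid k ++ (true ∷ true ∷ true ∷ []))

World : ℕ → Set
World k = Fin (length (chain k))

𝔐 : ℕ → Model
𝔐 k = record
  { W = World k
  ; R = λ a b → ∣ toℕ a - toℕ b ∣ ≤ 1
  ; V = λ { zero w → T (lookup (chain k) w) ; (suc _) w → ⊥ }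
  }

-- index b of c^k_j = w_b : the middle of the j-th block.
-- chain k = true ∷ mid k ++ …, and mid j is a prefix of mid k (j ≤ k) ending with
-- the j-th block of 2j+1 p̄-worlds, occupying indices
-- length (mid j) ∸ 2j … length (mid j); its middle is length (mid j) ∸ j.
cIdx : ℕ → ℕ → ℕ
cIdx k j = length (mid j) ∸ j

module Submission where

-- The model 𝔐 k is a "line model": worlds are positions 0 … N on
-- a line, two worlds see each other iff they are at distance ≤ 1.  In such a
-- model □^d φ holds at x iff φ holds at every world within distance d, and
-- □^≤ d φ means (up to double negation) the same.  Hence x ⊨ ε i says: no
-- p-world lies within distance i of x, and (doubly negated) some p-world lies
-- within distance i+1.  The file therefore has three parts:
--   1. distance arithmetic on ℕ and the semantics of □^d, □^≤ d and ε i in an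
--      arbitrary line model;
--   2. the layout of the chain of 𝔐 k: block m (the (m+1)-st block, of 2m+3
--      p̄-worlds) is preceded by the p-world at position Q m, and its middle
--      world c^k_{m+1} sits at position centre m = Q m + m + 2;
--   3. the theorem: the world c^k_{m+1} has only p̄-worlds within distance
--      m+1 and the p-world Q m at distance m+2, while every world strictly
--      before it has a p-world within distance m+1.

open import Defs
open import Data.Nat
  using (ℕ; zero; suc; _+_; _*_; _∸_; _≤_; _<_; _≤′_; ≤′-refl; ≤′-step;
         z<s; z≤n; s≤s; s≤s⁻¹; ∣_-_∣; _<?_; _≟_)
open import Data.Nat.Properties
open import Data.Nat.Tactic.RingSolver using (solve-∀)
open import Data.Bool using (Bool; true; false; T)
open import Data.Unit using (tt)
open import Data.List using (List; []; _∷_; _++_; replicate; length; lookup)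
open import Data.List.Properties using (length-++; ++-assoc; ++-identityʳ; length-replicate)
open import Data.Fin using (Fin; toℕ; fromℕ<)
open import Data.Fin.Properties using (toℕ<n; toℕ-fromℕ<; toℕ-injective)
open import Data.Empty using (⊥-elim)
open import Data.Product using (Σ; _×_; _,_; ∃)
open import Data.Sum using (_⊎_; inj₁; inj₂; [_,_]′)
open import Relation.Nullary using (¬_; yes; no)
open import Relation.Binary.PropositionalEquality
  using (_≡_; refl; sym; trans; cong; subst; subst₂; module ≡-Reasoning)
open import Function.Bundles using (_⇔_; mk⇔)

∣-∣≤-elim : ∀ a b {d} → ∣ a - b ∣ ≤ d → (a ≤ b + d) × (b ≤ a + d)
∣-∣≤-elim a b h = ≤-trans (m≤n+∣m-n∣ a b) (+-monoʳ-≤ b h)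
                , ≤-trans (m≤n+∣n-m∣ b a) (+-monoʳ-≤ a h)

∣-∣≤-intro : ∀ a b {d} → a ≤ b + d → b ≤ a + d → ∣ a - b ∣ ≤ d
∣-∣≤-intro a b {d} a≤ b≤ with ≤-total a b
... | inj₁ a≤b = subst (_≤ d) (sym (m≤n⇒∣m-n∣≡n∸m a≤b)) (m≤n+o⇒m∸n≤o b a b≤)
... | inj₂ b≤a = subst (_≤ d) (sym (m≤n⇒∣n-m∣≡n∸m b≤a)) (m≤n+o⇒m∸n≤o a b a≤)

∣1+n-n∣≡1 : ∀ n → ∣ suc n - n ∣ ≡ 1
∣1+n-n∣≡1 n = trans (m≤n⇒∣n-m∣≡n∸m (n≤1+n n)) (m+n∸n≡m 1 n)

-- A target within distance d+1 of a is reached through a neighbour of a that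
-- lies no further out than a or the target (so it stays inside any range).
step-towards : ∀ a b {d} → ∣ a - b ∣ ≤ suc d →
               Σ ℕ λ c → (∣ a - c ∣ ≤ 1) × (∣ c - b ∣ ≤ d) × (c ≤ a ⊎ c ≤ b)
step-towards zero    zero    _         = zero , z≤n , z≤n , inj₁ z≤n
step-towards zero    (suc b) (s≤s b≤d) = 1 , ≤-refl , b≤d , inj₂ (s≤s z≤n)
step-towards (suc a) zero    (s≤s a≤d) =
  a , ≤-reflexive (∣1+n-n∣≡1 a) , subst (_≤ _) (sym (∣-∣-identityʳ a)) a≤d , inj₁ (n≤1+n a)
step-towards (suc a) (suc b) h with step-towards a b h
... | c , ac , cb , inj₁ c≤a = suc c , ac , cb , inj₁ (s≤s c≤a)
... | c , ac , cb , inj₂ c≤b = suc c , ac , cb , inj₂ (s≤s c≤b)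

line : (n : ℕ) → (ℕ → Fin n → Set) → Model
line n val = record { W = Fin n ; R = λ a b → ∣ toℕ a - toℕ b ∣ ≤ 1 ; V = val }

module Line (n : ℕ) (val : ℕ → Fin n → Set) where

  private
    M : Model
    M = line n val

  neighbour : ∀ {d} (x y : Fin n) → ∣ toℕ x - toℕ y ∣ ≤ suc d →
              Σ (Fin n) λ z → (∣ toℕ x - toℕ z ∣ ≤ 1) × (∣ toℕ z - toℕ y ∣ ≤ d)
  neighbour {d} x y h with step-towards (toℕ x) (toℕ y) h
  ... | c , xc , cy , between =
      fromℕ< c<n
    , subst (λ v → ∣ toℕ x - v ∣ ≤ 1) (sym (toℕ-fromℕ< c<n)) xc
    , subst (λ v → ∣ v - toℕ y ∣ ≤ d) (sym (toℕ-fromℕ< c<n)) cy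
    where
      c<n : c < n
      c<n = [ (λ c≤x → ≤-<-trans c≤x (toℕ<n x)) , (λ c≤y → ≤-<-trans c≤y (toℕ<n y)) ]′ between

  □^-elim : ∀ {φ} d (x y : Fin n) → M , x ⊨ □^ d φ → ∣ toℕ x - toℕ y ∣ ≤ d → M , y ⊨ φ
  □^-elim {φ} zero x y x⊨ h =
    subst (λ w → M , w ⊨ φ) (toℕ-injective (∣m-n∣≡0⇒m≡n (n≤0⇒n≡0 h))) x⊨
  □^-elim (suc d) x y x⊨ h with neighbour x y h
  ... | z , xz , zy = □^-elim d z y (x⊨ z xz) zy

  □^-intro : ∀ {φ} d (x : Fin n) → (∀ y → ∣ toℕ x - toℕ y ∣ ≤ d → M , y ⊨ φ) → M , x ⊨ □^ d φ
  □^-intro zero    x all = all x (≤-reflexive (∣n-n∣≡0 (toℕ x)))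
  □^-intro (suc d) x all z xz = □^-intro d z λ y zy →
    all y (≤-trans (∣-∣-triangle (toℕ x) (toℕ z) (toℕ y)) (+-mono-≤ xz zy))

  □^≤-intro : ∀ {φ} d (x : Fin n) → (∀ y → ∣ toℕ x - toℕ y ∣ ≤ d → M , y ⊨ φ) → M , x ⊨ □^≤ d φ
  □^≤-intro zero    x all = all x (≤-reflexive (∣n-n∣≡0 (toℕ x)))
  □^≤-intro (suc d) x all ¬both =
    ¬both (□^≤-intro d x (λ y xy → all y (m≤n⇒m≤1+n xy))) (□^-intro (suc d) x all)

  -- The conjunction inside □^≤ is classical, so only ¬¬ □^d survives.
  □^≤-elim : ∀ {φ} d (x : Fin n) → M , x ⊨ □^≤ d φ → ¬ ¬ (M , x ⊨ □^ d φ)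
  □^≤-elim zero    x x⊨ ¬□ = ¬□ x⊨
  □^≤-elim (suc d) x x⊨ ¬□ = x⊨ (λ _ □ → ¬□ □)

  ε-elim : ∀ i (x y : Fin n) → M , x ⊨ ε i → ∣ toℕ x - toℕ y ∣ ≤ i → ¬ (M , y ⊨ p)
  ε-elim i x y x⊨ε xy y⊨p =
    x⊨ε (λ □≤ _ → □^≤-elim i x □≤ (λ □ → □^-elim i x y □ xy y⊨p))

  ε-intro : ∀ i (x y : Fin n) → (∀ z → ∣ toℕ x - toℕ z ∣ ≤ i → ¬ (M , z ⊨ p)) →
            ∣ toℕ x - toℕ y ∣ ≤ suc i → M , y ⊨ p → M , x ⊨ ε i
  ε-intro i x y no-p xy y⊨p ¬both =
    ¬both (□^≤-intro i x no-p) (λ □ → □^-elim (suc i) x y □ xy y⊨p)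

-- The entry at position t; positions past the end read as false (p̄).
nth : List Bool → ℕ → Bool
nth []       _       = false
nth (b ∷ bs) zero    = b
nth (b ∷ bs) (suc t) = nth bs t

lookup≡nth : ∀ bs (t : Fin (length bs)) → lookup bs t ≡ nth bs (toℕ t)
lookup≡nth (b ∷ bs) Fin.zero    = refl
lookup≡nth (b ∷ bs) (Fin.suc t) = lookup≡nth bs t

nth-true⇒< : ∀ bs t → nth bs t ≡ true → t < length bs
nth-true⇒< (b ∷ bs) zero    _ = s≤s z≤n
nth-true⇒< (b ∷ bs) (suc t) e = s≤s (nth-true⇒< bs t e)

nth-++ˡ : ∀ bs cs t → t < length bs → nth (bs ++ cs) t ≡ nth bs t
nth-++ˡ (b ∷ bs) cs zero    _         = refl
nth-++ˡ (b ∷ bs) cs (suc t) (s≤s t<n) = nth-++ˡ bs cs t t<n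

nth-++ʳ : ∀ bs cs t → nth (bs ++ cs) (length bs + t) ≡ nth cs t
nth-++ʳ []       cs t = refl
nth-++ʳ (b ∷ bs) cs t = nth-++ʳ bs cs t

nth-replicate-false : ∀ n t → nth (replicate n false) t ≡ false
nth-replicate-false zero    t       = refl
nth-replicate-false (suc n) zero    = refl
nth-replicate-false (suc n) (suc t) = nth-replicate-false n t

blockLength : ℕ → ℕ
blockLength m = 2 * suc m + 1

-- The chain up to and including block m-1: root, then each block preceded
-- by one p-world (the root doubling as the p-world before block 0).
pre : ℕ → List Bool
pre zero    = []
pre (suc m) = pre m ++ true ∷ replicate (blockLength m) false

-- Position of the p-world immediately preceding block m.
Q : ℕ → ℕ
Q m = length (pre m)

-- Position of the middle world of block m, i.e. of c^k_{m+1}.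
centre : ℕ → ℕ
centre m = Q m + suc (suc m)

Q-suc : ∀ m → Q (suc m) ≡ Q m + suc (blockLength m)
Q-suc m = trans (length-++ (pre m))
                (cong (λ l → Q m + suc l) (length-replicate (blockLength m)))

block-end : ∀ m → Q m + blockLength m ≡ centre m + suc m
block-end m = identity (Q m) m
  where
    identity : ∀ q m → q + (2 * suc m + 1) ≡ q + suc (suc m) + suc m
    identity = solve-∀

next-p-world : ∀ m → Q (suc m) ≡ centre m + suc (suc m)
next-p-world m = begin
  Q (suc m)                      ≡⟨ Q-suc m ⟩
  Q m + suc (blockLength m)      ≡⟨ +-suc (Q m) (blockLength m) ⟩
  suc (Q m + blockLength m)      ≡⟨ cong suc (block-end m) ⟩
  suc (centre m + suc m)         ≡⟨ sym (+-suc (centre m) (suc m)) ⟩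
  centre m + suc (suc m)         ∎
  where open ≡-Reasoning

pre≡root∷mid : ∀ m → pre (suc m) ≡ true ∷ mid (suc m)
pre≡root∷mid zero    = refl
pre≡root∷mid (suc m) =
  cong (_++ true ∷ replicate (blockLength (suc m)) false) (pre≡root∷mid m)

mid-step : ∀ j → ∃ λ zs → mid (suc j) ≡ mid j ++ zs
mid-step zero    = replicate 3 false , refl
mid-step (suc j) = _ , refl

mid-prefix : ∀ {j k} → j ≤′ k → ∃ λ zs → mid k ≡ mid j ++ zs
mid-prefix {j} ≤′-refl = [] , sym (++-identityʳ (mid j))
mid-prefix {j} (≤′-step {k} j≤k) with mid-prefix j≤k | mid-step k
... | zs , mid-k | ws , mid-suc-k = zs ++ ws , (begin
  mid (suc k)           ≡⟨ mid-suc-k ⟩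
  mid k ++ ws           ≡⟨ cong (_++ ws) mid-k ⟩
  (mid j ++ zs) ++ ws   ≡⟨ ++-assoc (mid j) zs ws ⟩
  mid j ++ (zs ++ ws)   ∎)
  where open ≡-Reasoning

chain-prefix : ∀ {k m} → suc m ≤ k → ∃ λ rest → chain k ≡ pre (suc m) ++ rest
chain-prefix {k} {m} m<k with mid-prefix (≤⇒≤′ m<k)
... | zs , mid-k = zs ++ tail , (begin
  true ∷ (mid k ++ tail)                ≡⟨ cong (λ l → true ∷ (l ++ tail)) mid-k ⟩
  true ∷ ((mid (suc m) ++ zs) ++ tail)  ≡⟨ cong (true ∷_) (++-assoc (mid (suc m)) zs tail) ⟩
  true ∷ mid (suc m) ++ (zs ++ tail)    ≡⟨ cong (_++ zs ++ tail) (sym (pre≡root∷mid m)) ⟩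
  pre (suc m) ++ (zs ++ tail)           ∎)
  where
    open ≡-Reasoning
    tail : List Bool
    tail = true ∷ true ∷ true ∷ []

nth-chain : ∀ {k m t} → suc m ≤ k → t < Q (suc m) → nth (chain k) t ≡ nth (pre (suc m)) t
nth-chain {k} {m} {t} m<k t<Q with chain-prefix {k} m<k
... | rest , chain-k = trans (cong (λ l → nth l t) chain-k) (nth-++ˡ (pre (suc m)) rest t t<Q)

p-before-block : ∀ {k m} → suc m ≤ k → nth (chain k) (Q m) ≡ true
p-before-block {k} {m} m<k = begin
  nth (chain k) (Q m)            ≡⟨ nth-chain m<k Q<Q-suc ⟩
  nth (pre (suc m)) (Q m)        ≡⟨ cong (nth (pre (suc m))) (sym (+-identityʳ (Q m))) ⟩
  nth (pre (suc m)) (Q m + 0)    ≡⟨ nth-++ʳ (pre m) _ 0 ⟩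
  true                           ∎
  where
    open ≡-Reasoning
    Q<Q-suc : Q m < Q (suc m)
    Q<Q-suc = subst (Q m <_) (sym (Q-suc m)) (m<m+n (Q m) z<s)

p̄-in-block : ∀ {k m t} → suc m ≤ k → Q m < t → t ≤ Q m + blockLength m → nth (chain k) t ≡ false
p̄-in-block {k} {m} m<k Q<t t≤end with m≤n⇒∃[o]m+o≡n Q<t
p̄-in-block {k} {m} m<k Q<t t≤end | o , refl = begin
  nth (chain k) (suc (Q m + o))             ≡⟨ nth-chain m<k t<Q-suc ⟩
  nth (pre (suc m)) (suc (Q m + o))         ≡⟨ cong (nth (pre (suc m))) (sym (+-suc (Q m) o)) ⟩
  nth (pre (suc m)) (Q m + suc o)           ≡⟨ nth-++ʳ (pre m) _ (suc o) ⟩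
  nth (replicate (blockLength m) false) o   ≡⟨ nth-replicate-false (blockLength m) o ⟩
  false                                     ∎
  where
    open ≡-Reasoning
    t<Q-suc : suc (Q m + o) < Q (suc m)
    t<Q-suc = subst (suc (Q m + o) <_) (trans (sym (+-suc (Q m) _)) (sym (Q-suc m))) (s≤s t≤end)

cIdx≡centre : ∀ k m → cIdx k (suc m) ≡ centre m
cIdx≡centre k m = begin
  length (mid (suc m)) ∸ suc m   ≡⟨ cong (_∸ suc m) length-mid ⟩
  centre m + suc m ∸ suc m       ≡⟨ m+n∸n≡m (centre m) (suc m) ⟩
  centre m                       ∎
  where
    open ≡-Reasoning
    length-mid : length (mid (suc m)) ≡ centre m + suc m
    length-mid = suc-injective (begin
      suc (length (mid (suc m)))   ≡⟨ cong length (sym (pre≡root∷mid m)) ⟩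
      Q (suc m)                    ≡⟨ Q-suc m ⟩
      Q m + suc (blockLength m)    ≡⟨ +-suc (Q m) (blockLength m) ⟩
      suc (Q m + blockLength m)    ≡⟨ cong suc (block-end m) ⟩
      suc (centre m + suc m)       ∎)

p̄-around-centre : ∀ {k m} y → suc m ≤ k → ∣ centre m - y ∣ ≤ suc m → nth (chain k) y ≡ false
p̄-around-centre {m = m} y m<k close with ∣-∣≤-elim (centre m) y close
... | centre≤ , ≤centre = p̄-in-block m<k block-start≤y (subst (y ≤_) (sym (block-end m)) ≤centre)
  where
    block-start≤y : suc (Q m) ≤ y
    block-start≤y = +-cancelʳ-≤ (suc m) (suc (Q m)) y
                      (subst (_≤ y + suc m) (+-suc (Q m) (suc m)) centre≤)

∣centre-Q∣ : ∀ m → ∣ centre m - Q m ∣ ≡ suc (suc m)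
∣centre-Q∣ m = trans (∣-∣-comm (centre m) (Q m)) (∣m-m+n∣≡n (Q m) (suc (suc m)))

-- Every position before the centre of block m has a p-world within distance
-- m+1.  Induction on m: a position before the centre of block m-1 is handled
-- by the hypothesis; one between the two centres is within distance m+1 of
-- the p-world Q m separating the two blocks.
p-near-before-centre : ∀ {k} m → suc m ≤ k → ∀ t → t < centre m →
                       Σ ℕ λ y → (nth (chain k) y ≡ true) × (∣ t - y ∣ ≤ suc m)
p-near-before-centre zero m<k t t<2 =
  0 , p-before-block m<k , subst (_≤ 1) (sym (∣-∣-identityʳ t)) (s≤s⁻¹ t<2)
p-near-before-centre (suc m) m<k t t<c with t <? centre m
... | yes t<c′ with p-near-before-centre m (<⇒≤ m<k) t t<c′
...   | y , py , ty = y , py , m≤n⇒m≤1+n ty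
p-near-before-centre (suc m) m<k t t<c | no t≮c′ =
  Q (suc m) , p-before-block m<k , ∣-∣≤-intro t (Q (suc m)) t≤ Q≤
  where
    t≤ : t ≤ Q (suc m) + suc (suc m)
    t≤ = s≤s⁻¹ (subst (suc t ≤_) (+-suc (Q (suc m)) (suc (suc m))) t<c)
    Q≤ : Q (suc m) ≤ t + suc (suc m)
    Q≤ = subst (_≤ t + suc (suc m)) (sym (next-p-world m)) (+-monoˡ-≤ (suc (suc m)) (≮⇒≥ t≮c′))

p-world : ∀ {k t} → nth (chain k) t ≡ true → Σ (World k) λ y → (toℕ y ≡ t) × (𝔐 k , y ⊨ p)
p-world {k} {t} e = y , toℕ-fromℕ< t<N , subst T (sym lookup-y) tt
  where
    t<N : t < length (chain k)
    t<N = nth-true⇒< (chain k) t e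
    y : World k
    y = fromℕ< t<N
    lookup-y : lookup (chain k) y ≡ true
    lookup-y = trans (lookup≡nth (chain k) y) (trans (cong (nth (chain k)) (toℕ-fromℕ< t<N)) e)

p̄-world : ∀ {k} (y : World k) → nth (chain k) (toℕ y) ≡ false → ¬ (𝔐 k , y ⊨ p)
p̄-world {k} y e = subst T (trans (lookup≡nth (chain k) y) e)

lemma3 : (k : ℕ) → 1 ≤ k → (i : ℕ) → 1 ≤ i → i ≤ k →
         (x : World k) → toℕ x ≤ cIdx k i →
         ((𝔐 k , x ⊨ ε i) ⇔ (toℕ x ≡ cIdx k i))
lemma3 k _ (suc m) (s≤s z≤n) m<k x x≤c = mk⇔ ε⇒centre centre⇒ε
  where
    open Line (length (chain k)) (V (𝔐 k))

    -- Before the centre, a p-world within distance m+1 refutes ε (m+1).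
    ε⇒centre : 𝔐 k , x ⊨ ε (suc m) → toℕ x ≡ cIdx k (suc m)
    ε⇒centre x⊨ε with toℕ x ≟ cIdx k (suc m)
    ... | yes x≡c = x≡c
    ... | no x≢c with p-near-before-centre m m<k (toℕ x)
                        (subst (toℕ x <_) (cIdx≡centre k m) (≤∧≢⇒< x≤c x≢c))
    ...   | t , pt , xt with p-world {k} {t} pt
    ...     | y , refl , y⊨p = ⊥-elim (ε-elim (suc m) x y x⊨ε xt y⊨p)

    -- At the centre, the block supplies □^≤ (m+1) ¬p and Q m supplies ◇^(m+2) p.
    centre⇒ε : toℕ x ≡ cIdx k (suc m) → 𝔐 k , x ⊨ ε (suc m)
    centre⇒ε x≡c with p-world {k} (p-before-block m<k)
    ... | y , y≡Q , y⊨p = ε-intro (suc m) x y no-p-near x-y y⊨p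
      where
        x≡centre : toℕ x ≡ centre m
        x≡centre = trans x≡c (cIdx≡centre k m)
        no-p-near : ∀ z → ∣ toℕ x - toℕ z ∣ ≤ suc m → ¬ (𝔐 k , z ⊨ p)
        no-p-near z xz = p̄-world {k} z (p̄-around-centre {k} (toℕ z) m<k
                           (subst (λ v → ∣ v - toℕ z ∣ ≤ suc m) x≡centre xz))
        x-y : ∣ toℕ x - toℕ y ∣ ≤ suc (suc m)
        x-y = subst₂ (λ u v → ∣ u - v ∣ ≤ suc (suc m)) (sym x≡centre) (sym y≡Q)
                (≤-reflexive (∣centre-Q∣ m))
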